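{- There are infinitely many equivalence classes of rational face cuboids.
   Context: A cuboid $ABCD\text{ - }EFGH$ is a rectangular box with opposite faces $ABCD$ and $EFGH$, where $A,B,C,D$ are joined by edges to $E,F,G,H$ respectively. It is a rational face cuboid if the edges $BF,EF,FG$, the face diagonals $BE$ (of face $ABFE$) and $HF$ (of face $EFGH$), and the space diagonal $DF$ all have positive rational length. Two rational face cuboids $ABCD\text{ - }EFGH$ and $A'B'C'D'\text{ - }E'F'G'H'$ are equivalent if there is a rational $\lambda$ with $BF=\lambda B'F'$, $EF=\lambda E'F'$, $GF=\lambda G'F'$. -}

module Defs where

open import Data.Nat using (ℕ)
open import Data.Rational using (ℚ; 0ℚ; _+_; _*_; _<_)
open import Data.Product using (Σ; ∃; _×_)
open import Relation.Binary.PropositionalEquality using (_≡_)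

-- A length ℓ (a positive real) is rational iff some positive rational q has q² = ℓ².
-- "RationalLength s" : the length whose square is s is a positive rational.
RationalLength : ℚ → Set
RationalLength s = ∃ λ q → (0ℚ < q) × (q * q ≡ s)

-- Edges of the box: a = BF, b = EF, c = FG (pairwise orthogonal, meeting at F).
record Edges : Set where
  constructor edges
  field
    BF EF FG : ℚ

open Edges public

IsRationalFaceCuboid : Edges → Set
IsRationalFaceCuboid (edges a b c) =
  (0ℚ < a) × (0ℚ < b) × (0ℚ < c) ×
  RationalLength (a * a + b * b) ×
  RationalLength (b * b + c * c) ×
  RationalLength (a * a + b * b + c * c)

Equivalent : Edges → Edges → Set
Equivalent (edges a b c) (edges a' b' c') =
  ∃ λ (l : ℚ) → (a ≡ l * a') × (b ≡ l * b') × (c ≡ l * c')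

InfinitelyManyClasses : Set
InfinitelyManyClasses =
  Σ (ℕ → Edges) λ f →
    ((n : ℕ) → IsRationalFaceCuboid (f n)) ×
    ((i j : ℕ) → Equivalent (f i) (f j) → i ≡ j)

-- There is a one-parameter family of integer cuboids with edges a(n), b(n), c(n) whose
-- diagonals d(n), e(n), g(n) are polynomials as well, so that d² = a² + b²,
-- e² = b² + c² and g² = a² + b² + c² are polynomial identities. Equivalent cuboids
-- have the same ratio EF : FG, and b(n)/c(n) is strictly increasing because
-- b(n+1) c(n) − b(n) c(n+1) is a polynomial with positive coefficients; hence no two
-- members of the family are equivalent.
module Submission where

open import Defs
open import Algebra.Bundles using (CommutativeRing)
open import Data.List using (List; []; _∷_; map)
open import Data.Nat as ℕ using (ℕ; suc; _+_; _*_; z<s; _<′_; ≤′-refl; ≤′-step)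
import Data.Nat.Properties as ℕ
open import Data.Nat.Tactic.RingSolver using (solve-∀)
open import Data.Rational as ℚ using (ℚ; 0ℚ; 1ℚ)
import Data.Rational.Properties as ℚ
open import Data.Product using (_,_)
open import Relation.Binary using (tri<; tri≈; tri>)
open import Relation.Binary.PropositionalEquality
open import Relation.Nullary using (contradiction)

open import Algebra.Properties.Semiring.Mult (CommutativeRing.semiring ℚ.+-*-commutativeRing)
  using (_×_; ×-homo-+; ×1-homo-*)

Poly : Set
Poly = List ℕ

⟦_⟧ : Poly → ℕ → ℕ
⟦ [] ⟧    x = 0
⟦ c ∷ p ⟧ x = c + x * ⟦ p ⟧ x

infixl 6 _+ₚ_
infixl 7 _*ₚ_

_+ₚ_ : Poly → Poly → Poly
[]      +ₚ q       = q
(a ∷ p) +ₚ []      = a ∷ p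
(a ∷ p) +ₚ (b ∷ q) = a + b ∷ p +ₚ q

_*ₚ_ : Poly → Poly → Poly
[]      *ₚ q = []
(c ∷ p) *ₚ q = map (c *_) q +ₚ (0 ∷ p *ₚ q)

shift : Poly → Poly
shift []      = []
shift (c ∷ p) = (c ∷ []) +ₚ (1 ∷ 1 ∷ []) *ₚ shift p

⟦⟧-homo-+ : ∀ p q x → ⟦ p +ₚ q ⟧ x ≡ ⟦ p ⟧ x + ⟦ q ⟧ x
⟦⟧-homo-+ []      q       x = refl
⟦⟧-homo-+ (a ∷ p) []      x = sym (ℕ.+-identityʳ _)
⟦⟧-homo-+ (a ∷ p) (b ∷ q) x = begin
  a + b + x * ⟦ p +ₚ q ⟧ x          ≡⟨ cong (λ t → a + b + x * t) (⟦⟧-homo-+ p q x) ⟩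
  a + b + x * (⟦ p ⟧ x + ⟦ q ⟧ x)   ≡⟨ lemma a b x (⟦ p ⟧ x) (⟦ q ⟧ x) ⟩
  a + x * ⟦ p ⟧ x + (b + x * ⟦ q ⟧ x) ∎
  where
  open ≡-Reasoning
  lemma : ∀ a b x u v → a + b + x * (u + v) ≡ a + x * u + (b + x * v)
  lemma = solve-∀

⟦⟧-map-* : ∀ c p x → ⟦ map (c *_) p ⟧ x ≡ c * ⟦ p ⟧ x
⟦⟧-map-* c []      x = sym (ℕ.*-zeroʳ c)
⟦⟧-map-* c (a ∷ p) x = begin
  c * a + x * ⟦ map (c *_) p ⟧ x ≡⟨ cong (λ t → c * a + x * t) (⟦⟧-map-* c p x) ⟩
  c * a + x * (c * ⟦ p ⟧ x)      ≡⟨ lemma c a x (⟦ p ⟧ x) ⟩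
  c * (a + x * ⟦ p ⟧ x)          ∎
  where
  open ≡-Reasoning
  lemma : ∀ c a x u → c * a + x * (c * u) ≡ c * (a + x * u)
  lemma = solve-∀

⟦⟧-homo-* : ∀ p q x → ⟦ p *ₚ q ⟧ x ≡ ⟦ p ⟧ x * ⟦ q ⟧ x
⟦⟧-homo-* []      q x = refl
⟦⟧-homo-* (c ∷ p) q x = begin
  ⟦ map (c *_) q +ₚ (0 ∷ p *ₚ q) ⟧ x             ≡⟨ ⟦⟧-homo-+ (map (c *_) q) (0 ∷ p *ₚ q) x ⟩
  ⟦ map (c *_) q ⟧ x + (0 + x * ⟦ p *ₚ q ⟧ x)    ≡⟨ cong₂ (λ s t → s + (0 + x * t))
                                                      (⟦⟧-map-* c q x) (⟦⟧-homo-* p q x) ⟩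
  c * ⟦ q ⟧ x + (0 + x * (⟦ p ⟧ x * ⟦ q ⟧ x))    ≡⟨ lemma c x (⟦ p ⟧ x) (⟦ q ⟧ x) ⟩
  (c + x * ⟦ p ⟧ x) * ⟦ q ⟧ x                    ∎
  where
  open ≡-Reasoning
  lemma : ∀ c x u v → c * v + (0 + x * (u * v)) ≡ (c + x * u) * v
  lemma = solve-∀

⟦⟧-shift : ∀ p x → ⟦ shift p ⟧ x ≡ ⟦ p ⟧ (suc x)
⟦⟧-shift []      x = refl
⟦⟧-shift (c ∷ p) x = begin
  ⟦ (c ∷ []) +ₚ (1 ∷ 1 ∷ []) *ₚ shift p ⟧ x
    ≡⟨ ⟦⟧-homo-+ (c ∷ []) ((1 ∷ 1 ∷ []) *ₚ shift p) x ⟩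
  ⟦ c ∷ [] ⟧ x + ⟦ (1 ∷ 1 ∷ []) *ₚ shift p ⟧ x
    ≡⟨ cong (⟦ c ∷ [] ⟧ x +_) (⟦⟧-homo-* (1 ∷ 1 ∷ []) (shift p) x) ⟩
  ⟦ c ∷ [] ⟧ x + ⟦ 1 ∷ 1 ∷ [] ⟧ x * ⟦ shift p ⟧ x
    ≡⟨ cong (λ t → ⟦ c ∷ [] ⟧ x + ⟦ 1 ∷ 1 ∷ [] ⟧ x * t) (⟦⟧-shift p x) ⟩
  c + x * 0 + (1 + x * (1 + x * 0)) * ⟦ p ⟧ (suc x)
    ≡⟨ lemma c x (⟦ p ⟧ (suc x)) ⟩
  c + suc x * ⟦ p ⟧ (suc x)
    ∎
  where
  open ≡-Reasoning
  lemma : ∀ c x u → c + x * 0 + (1 + x * (1 + x * 0)) * u ≡ c + suc x * u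
  lemma = solve-∀

Positive : Poly → Set
Positive p = ∀ x → 0 ℕ.< ⟦ p ⟧ x

⟦⟧-pos : ∀ p → 0 ℕ.< ⟦ p ⟧ 0 → Positive p
⟦⟧-pos (c ∷ p) c>0 x =
  ℕ.<-≤-trans (subst (0 ℕ.<_) (ℕ.+-identityʳ c) c>0) (ℕ.m≤m+n c (x * ⟦ p ⟧ x))

⟦⟧-sum-of-squares : ∀ p q r → r *ₚ r ≡ p *ₚ p +ₚ q *ₚ q →
                    ∀ x → ⟦ r ⟧ x * ⟦ r ⟧ x ≡ ⟦ p ⟧ x * ⟦ p ⟧ x + ⟦ q ⟧ x * ⟦ q ⟧ x
⟦⟧-sum-of-squares p q r eq x = begin
  ⟦ r ⟧ x * ⟦ r ⟧ x                  ≡⟨ ⟦⟧-homo-* r r x ⟨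
  ⟦ r *ₚ r ⟧ x                       ≡⟨ cong (λ s → ⟦ s ⟧ x) eq ⟩
  ⟦ p *ₚ p +ₚ q *ₚ q ⟧ x             ≡⟨ ⟦⟧-homo-+ (p *ₚ p) (q *ₚ q) x ⟩
  ⟦ p *ₚ p ⟧ x + ⟦ q *ₚ q ⟧ x        ≡⟨ cong₂ _+_ (⟦⟧-homo-* p p x) (⟦⟧-homo-* q q x) ⟩
  ⟦ p ⟧ x * ⟦ p ⟧ x + ⟦ q ⟧ x * ⟦ q ⟧ x ∎
  where open ≡-Reasoning

⟦⟧-sum-of-three-squares : ∀ p q r s → s *ₚ s ≡ p *ₚ p +ₚ q *ₚ q +ₚ r *ₚ r → ∀ x →
  ⟦ s ⟧ x * ⟦ s ⟧ x ≡ ⟦ p ⟧ x * ⟦ p ⟧ x + ⟦ q ⟧ x * ⟦ q ⟧ x + ⟦ r ⟧ x * ⟦ r ⟧ x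
⟦⟧-sum-of-three-squares p q r s eq x = begin
  ⟦ s ⟧ x * ⟦ s ⟧ x                      ≡⟨ ⟦⟧-homo-* s s x ⟨
  ⟦ s *ₚ s ⟧ x                           ≡⟨ cong (λ u → ⟦ u ⟧ x) eq ⟩
  ⟦ p *ₚ p +ₚ q *ₚ q +ₚ r *ₚ r ⟧ x       ≡⟨ ⟦⟧-homo-+ (p *ₚ p +ₚ q *ₚ q) (r *ₚ r) x ⟩
  ⟦ p *ₚ p +ₚ q *ₚ q ⟧ x + ⟦ r *ₚ r ⟧ x  ≡⟨ cong₂ _+_ (⟦⟧-homo-+ (p *ₚ p) (q *ₚ q) x)
                                                      (⟦⟧-homo-* r r x) ⟩
  ⟦ p *ₚ p ⟧ x + ⟦ q *ₚ q ⟧ x + ⟦ r ⟧ x * ⟦ r ⟧ x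
    ≡⟨ cong₂ (λ u v → u + v + ⟦ r ⟧ x * ⟦ r ⟧ x) (⟦⟧-homo-* p p x) (⟦⟧-homo-* q q x) ⟩
  ⟦ p ⟧ x * ⟦ p ⟧ x + ⟦ q ⟧ x * ⟦ q ⟧ x + ⟦ r ⟧ x * ⟦ r ⟧ x ∎
  where open ≡-Reasoning

module _ (f g : ℕ → ℕ) (g>0 : ∀ n → 0 ℕ.< g n)
         (f/g-step : ∀ n → f n * g (suc n) ℕ.< f (suc n) * g n) where

  f/g-strictMono : ∀ {i j} → i <′ j → f i * g j ℕ.< f j * g i
  f/g-strictMono {i} ≤′-refl = f/g-step i
  f/g-strictMono {i} (≤′-step {j} i<j) =
    ℕ.*-cancelʳ-< (g j) (f i * g (suc j)) (f (suc j) * g i) (begin-strict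
      f i * g (suc j) * g j  ≡⟨ swap (f i) (g (suc j)) (g j) ⟩
      f i * g j * g (suc j)  <⟨ ℕ.*-monoˡ-< (g (suc j)) ⦃ ℕ.>-nonZero (g>0 (suc j)) ⦄
                                  (f/g-strictMono i<j) ⟩
      f j * g i * g (suc j)  ≡⟨ swap (f j) (g i) (g (suc j)) ⟩
      f j * g (suc j) * g i  <⟨ ℕ.*-monoˡ-< (g i) ⦃ ℕ.>-nonZero (g>0 i) ⦄ (f/g-step j) ⟩
      f (suc j) * g j * g i  ≡⟨ swap (f (suc j)) (g j) (g i) ⟩
      f (suc j) * g i * g j  ∎)
    where
    open ℕ.≤-Reasoning
    swap : ∀ a b c → a * b * c ≡ a * c * b
    swap = solve-∀

  f/g-injective : ∀ {i j} → f i * g j ≡ f j * g i → i ≡ j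
  f/g-injective {i} {j} eq with ℕ.<-cmp i j
  ... | tri< i<j _ _ = contradiction eq (ℕ.<⇒≢ (f/g-strictMono (ℕ.<⇒<′ i<j)))
  ... | tri≈ _ i≡j _ = i≡j
  ... | tri> _ _ j<i = contradiction (sym eq) (ℕ.<⇒≢ (f/g-strictMono (ℕ.<⇒<′ j<i)))

fromℕ : ℕ → ℚ
fromℕ n = n × 1ℚ

fromℕ-+ : ∀ m n → fromℕ (m + n) ≡ fromℕ m ℚ.+ fromℕ n
fromℕ-+ = ×-homo-+ 1ℚ

fromℕ-* : ∀ m n → fromℕ (m * n) ≡ fromℕ m ℚ.* fromℕ n
fromℕ-* = ×1-homo-*

fromℕ-<-suc : ∀ n → fromℕ n ℚ.< fromℕ (suc n)
fromℕ-<-suc n = subst (ℚ._< fromℕ (suc n)) (ℚ.+-identityˡ (fromℕ n))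
                      (ℚ.+-monoˡ-< (fromℕ n) (ℚ.positive⁻¹ 1ℚ))

fromℕ-strictMono : ∀ {m n} → m <′ n → fromℕ m ℚ.< fromℕ n
fromℕ-strictMono {m} ≤′-refl          = fromℕ-<-suc m
fromℕ-strictMono     (≤′-step {n} m<n) = ℚ.<-trans (fromℕ-strictMono m<n) (fromℕ-<-suc n)

fromℕ-pos : ∀ {n} → 0 ℕ.< n → 0ℚ ℚ.< fromℕ n
fromℕ-pos n>0 = fromℕ-strictMono (ℕ.<⇒<′ n>0)

fromℕ-injective : ∀ {m n} → fromℕ m ≡ fromℕ n → m ≡ n
fromℕ-injective {m} {n} eq with ℕ.<-cmp m n
... | tri< m<n _ _ = contradiction eq (ℚ.<⇒≢ (fromℕ-strictMono (ℕ.<⇒<′ m<n)))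
... | tri≈ _ m≡n _ = m≡n
... | tri> _ _ n<m = contradiction (sym eq) (ℚ.<⇒≢ (fromℕ-strictMono (ℕ.<⇒<′ n<m)))

rationalLength-fromℕ : ∀ {d s} → 0 ℕ.< d → d * d ≡ s → RationalLength (fromℕ s)
rationalLength-fromℕ {d} d>0 eq =
  fromℕ d , fromℕ-pos d>0 , trans (sym (fromℕ-* d d)) (cong fromℕ eq)

isRationalFaceCuboid-fromℕ : ∀ {a b c d e g} → 0 ℕ.< a → 0 ℕ.< b → 0 ℕ.< c →
  0 ℕ.< d → 0 ℕ.< e → 0 ℕ.< g →
  d * d ≡ a * a + b * b → e * e ≡ b * b + c * c → g * g ≡ a * a + b * b + c * c →
  IsRationalFaceCuboid (edges (fromℕ a) (fromℕ b) (fromℕ c))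
isRationalFaceCuboid-fromℕ {a} {b} {c} a>0 b>0 c>0 d>0 e>0 g>0 BE HF DF =
  fromℕ-pos a>0 , fromℕ-pos b>0 , fromℕ-pos c>0 ,
  subst RationalLength (sum₂ a b) (rationalLength-fromℕ d>0 BE) ,
  subst RationalLength (sum₂ b c) (rationalLength-fromℕ e>0 HF) ,
  subst RationalLength sum₃ (rationalLength-fromℕ g>0 DF)
  where
  sum₂ : ∀ x y → fromℕ (x * x + y * y) ≡ fromℕ x ℚ.* fromℕ x ℚ.+ fromℕ y ℚ.* fromℕ y
  sum₂ x y = trans (fromℕ-+ (x * x) (y * y)) (cong₂ ℚ._+_ (fromℕ-* x x) (fromℕ-* y y))
  sum₃ : fromℕ (a * a + b * b + c * c)
       ≡ fromℕ a ℚ.* fromℕ a ℚ.+ fromℕ b ℚ.* fromℕ b ℚ.+ fromℕ c ℚ.* fromℕ c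
  sum₃ = trans (fromℕ-+ (a * a + b * b) (c * c)) (cong₂ ℚ._+_ (sum₂ a b) (fromℕ-* c c))

equivalent⇒EF*FG′≡EF′*FG : ∀ {x x′} → Equivalent x x′ → EF x ℚ.* FG x′ ≡ EF x′ ℚ.* FG x
equivalent⇒EF*FG′≡EF′*FG {edges _ b c} {edges _ b′ c′} (l , _ , b≡lb′ , c≡lc′) = begin
  b ℚ.* c′          ≡⟨ cong (ℚ._* c′) b≡lb′ ⟩
  l ℚ.* b′ ℚ.* c′   ≡⟨ cong (ℚ._* c′) (ℚ.*-comm l b′) ⟩
  b′ ℚ.* l ℚ.* c′   ≡⟨ ℚ.*-assoc b′ l c′ ⟩
  b′ ℚ.* (l ℚ.* c′) ≡⟨ cong (b′ ℚ.*_) c≡lc′ ⟨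
  b′ ℚ.* c          ∎
  where open ≡-Reasoning

-- With t = n + 5 the edges are a = (t² − 1)(t⁸ − 20t⁶ − 26t⁴ − 20t² + 1),
-- b = 2t(3t⁸ − 12t⁶ − 46t⁴ − 12t² + 3), c = 8t(t⁴ − 1)(t⁴ + 6t² + 1); the shift
-- t = n + 5 makes all coefficients nonnegative. Without opacity the typechecker
-- unfolds these coefficients while checking later terms and runs out of memory.
opaque
  a b c d e g : Poly
  a = 1473024 ∷ 6296960 ∷ 8335296 ∷ 5685120 ∷ 2360256 ∷ 640320 ∷ 116544 ∷ 14160 ∷ 1104 ∷ 50 ∷ 1 ∷ []
  b = 9553280 ∷ 18179456 ∷ 15184640 ∷ 7326976 ∷ 2255200 ∷ 459808 ∷ 62160 ∷ 5376 ∷ 270 ∷ 6 ∷ []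
  c = 19368960 ∷ 33371392 ∷ 25649280 ∷ 11549952 ∷ 3360000 ∷ 655200 ∷ 85680 ∷ 7248 ∷ 360 ∷ 8 ∷ []
  d = 9666176 ∷ 18926720 ∷ 16894272 ∷ 9016320 ∷ 3174816 ∷ 768480 ∷ 129216 ∷ 14880 ∷ 1122 ∷ 50 ∷ 1 ∷ []
  e = 21596800 ∷ 37970560 ∷ 29775360 ∷ 13665024 ∷ 4044000 ∷ 800160 ∷ 105840 ∷ 9024 ∷ 450 ∷ 10 ∷ []
  g = 21646976 ∷ 38311040 ∷ 30589504 ∷ 14535680 ∷ 4562784 ∷ 991520 ∷ 151584 ∷ 16160 ∷ 1154 ∷ 50 ∷ 1 ∷ []

  b/c-gap : Poly
  b/c-gap = 128613531678720 ∷ 348170792587264 ∷ 440179492977664 ∷ 344743725283072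
          ∷ 187045839918080 ∷ 74467904799872 ∷ 22473335208192 ∷ 5234769835488 ∷ 948867162144
          ∷ 133837870880 ∷ 14569627424 ∷ 1202086880 ∷ 72762976 ∷ 3050464 ∷ 79200 ∷ 960 ∷ []

opaque
  unfolding a b c d e g b/c-gap

  BE-diagonal : d *ₚ d ≡ a *ₚ a +ₚ b *ₚ b
  BE-diagonal = refl

  HF-diagonal : e *ₚ e ≡ b *ₚ b +ₚ c *ₚ c
  HF-diagonal = refl

  DF-diagonal : g *ₚ g ≡ a *ₚ a +ₚ b *ₚ b +ₚ c *ₚ c
  DF-diagonal = refl

  b/c-step : shift b *ₚ c ≡ b *ₚ shift c +ₚ b/c-gap
  b/c-step = refl

  a-pos : Positive a
  a-pos = ⟦⟧-pos a z<s
  b-pos : Positive b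
  b-pos = ⟦⟧-pos b z<s
  c-pos : Positive c
  c-pos = ⟦⟧-pos c z<s
  d-pos : Positive d
  d-pos = ⟦⟧-pos d z<s
  e-pos : Positive e
  e-pos = ⟦⟧-pos e z<s
  g-pos : Positive g
  g-pos = ⟦⟧-pos g z<s
  b/c-gap-pos : Positive b/c-gap
  b/c-gap-pos = ⟦⟧-pos b/c-gap z<s

b/c-increasing : ∀ n → ⟦ b ⟧ n * ⟦ c ⟧ (suc n) ℕ.< ⟦ b ⟧ (suc n) * ⟦ c ⟧ n
b/c-increasing n = subst (⟦ b ⟧ n * ⟦ c ⟧ (suc n) ℕ.<_) (sym gap)
                         (ℕ.m<m+n _ (b/c-gap-pos n))
  where
  open ≡-Reasoning
  gap : ⟦ b ⟧ (suc n) * ⟦ c ⟧ n ≡ ⟦ b ⟧ n * ⟦ c ⟧ (suc n) + ⟦ b/c-gap ⟧ n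
  gap = begin
    ⟦ b ⟧ (suc n) * ⟦ c ⟧ n                  ≡⟨ cong (_* ⟦ c ⟧ n) (⟦⟧-shift b n) ⟨
    ⟦ shift b ⟧ n * ⟦ c ⟧ n                  ≡⟨ ⟦⟧-homo-* (shift b) c n ⟨
    ⟦ shift b *ₚ c ⟧ n                       ≡⟨ cong (λ p → ⟦ p ⟧ n) b/c-step ⟩
    ⟦ b *ₚ shift c +ₚ b/c-gap ⟧ n            ≡⟨ ⟦⟧-homo-+ (b *ₚ shift c) b/c-gap n ⟩
    ⟦ b *ₚ shift c ⟧ n + ⟦ b/c-gap ⟧ n
      ≡⟨ cong (_+ ⟦ b/c-gap ⟧ n) (⟦⟧-homo-* b (shift c) n) ⟩
    ⟦ b ⟧ n * ⟦ shift c ⟧ n + ⟦ b/c-gap ⟧ n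
      ≡⟨ cong (λ t → ⟦ b ⟧ n * t + ⟦ b/c-gap ⟧ n) (⟦⟧-shift c n) ⟩
    ⟦ b ⟧ n * ⟦ c ⟧ (suc n) + ⟦ b/c-gap ⟧ n  ∎

cuboid : ℕ → Edges
cuboid n = edges (fromℕ (⟦ a ⟧ n)) (fromℕ (⟦ b ⟧ n)) (fromℕ (⟦ c ⟧ n))

cuboid-isRationalFaceCuboid : ∀ n → IsRationalFaceCuboid (cuboid n)
cuboid-isRationalFaceCuboid n = isRationalFaceCuboid-fromℕ
  (a-pos n) (b-pos n) (c-pos n) (d-pos n) (e-pos n) (g-pos n)
  (⟦⟧-sum-of-squares a b d BE-diagonal n) (⟦⟧-sum-of-squares b c e HF-diagonal n)
  (⟦⟧-sum-of-three-squares a b c g DF-diagonal n)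

cuboid-inequivalent : ∀ i j → Equivalent (cuboid i) (cuboid j) → i ≡ j
cuboid-inequivalent i j i~j =
  f/g-injective ⟦ b ⟧ ⟦ c ⟧ c-pos b/c-increasing (fromℕ-injective (begin
    fromℕ (⟦ b ⟧ i * ⟦ c ⟧ j)            ≡⟨ fromℕ-* (⟦ b ⟧ i) (⟦ c ⟧ j) ⟩
    fromℕ (⟦ b ⟧ i) ℚ.* fromℕ (⟦ c ⟧ j)  ≡⟨ equivalent⇒EF*FG′≡EF′*FG i~j ⟩
    fromℕ (⟦ b ⟧ j) ℚ.* fromℕ (⟦ c ⟧ i)  ≡⟨ fromℕ-* (⟦ b ⟧ j) (⟦ c ⟧ i) ⟨
    fromℕ (⟦ b ⟧ j * ⟦ c ⟧ i)            ∎))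
  where open ≡-Reasoning

corollary4p6 : InfinitelyManyClasses
corollary4p6 = cuboid , cuboid-isRationalFaceCuboid , cuboid-inequivalent
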